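{- Let $a\in\mathbb{N}$ with $a\geq 3$, and let $S(a)$ be the submonoid of $(\mathbb{N},+)$ generated by $\{f_a+f_n\mid n\in\mathbb{N}\}$. Then $\mathrm{F}(S(a))=\left\lfloor\frac{\mathrm{e}(S(a))}{2}\right\rfloor \mathrm{m}(S(a))-1$.
   Context: $\{f_n\}$ is the Fibonacci sequence ($f_0=0$, $f_1=1$, $f_{n+2}=f_{n+1}+f_n$). For a numerical semigroup $S$: $\mathrm{F}(S)$ is the largest integer not in $S$, $\mathrm{e}(S)$ is the cardinality of its minimal system of generators, and $\mathrm{m}(S)$ (multiplicity) is the least positive integer in $S$. -}

module Defs where

open import Data.Nat using (ℕ; zero; suc; _+_; _*_; _<_; _≤_; ⌊_/2⌋)
open import Data.List using (List; length)
open import Data.List.Membership.Propositional using (_∈_)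
open import Data.List.Relation.Unary.Unique.Propositional using (Unique)
open import Data.Product using (Σ; _×_)
open import Relation.Nullary using (¬_)
open import Relation.Binary.PropositionalEquality using (_≡_)

fib : ℕ → ℕ
fib zero = 0
fib (suc zero) = 1
fib (suc (suc n)) = fib (suc n) + fib n

data InS (a : ℕ) : ℕ → Set where
  zero∈ : InS a 0
  step∈ : ∀ {x} n → InS a x → InS a (x + (fib a + fib n))

data GenBy (G : List ℕ) : ℕ → Set where
  zero∈ : GenBy G 0
  step∈ : ∀ {x g} → g ∈ G → GenBy G x → GenBy G (x + g)

-- G (a finite set, as a duplicate-free list) is a system of generators of S(a)
Generates : ℕ → List ℕ → Set
Generates a G = (∀ {g} → g ∈ G → InS a g) × (∀ x → InS a x → GenBy G x)

IsMinimalGeneratingSystem : ℕ → List ℕ → Set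
IsMinimalGeneratingSystem a G =
  Unique G × Generates a G ×
  (∀ (H : List ℕ) → (∀ {h} → h ∈ H → h ∈ G) → Generates a H → ∀ {g} → g ∈ G → g ∈ H)

IsFrobenius : ℕ → ℕ → Set
IsFrobenius a F = ¬ InS a F × (∀ x → F < x → InS a x)

IsMultiplicity : ℕ → ℕ → Set
IsMultiplicity a m = 0 < m × InS a m × (∀ x → 0 < x → InS a x → m ≤ x)

{-# OPTIONS --safe #-}
module Submission where

-- Write m = f a. Since S(a) is generated by the m + f n, an integer x lies in S(a) as soon as
-- x = r + q m with r a sum of q Fibonacci numbers (f 0 = 0 allows fewer). The key fact is that
-- the greedy expansion is optimal: if f (k+2) ≤ N < f (k+3) is a sum of t + 1 Fibonacci
-- numbers, then N - f (k+2) is a sum of t of them. Consequently every r < m is a sum of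
-- ⌊(a-1)/2⌋ Fibonacci numbers while m - 1 is not a sum of fewer, and adding a generator to
-- x = (x % m) + (x / m) m keeps x % m a sum of x / m Fibonacci numbers; so the largest gap
-- is F = (m - 1) + ⌊(a-3)/2⌋ m. Nonzero elements of S(a) are at least m, so the elements
-- m + f n < 2m (n = 0, 2, …, a-1) lie in every generating system, which gives e = a - 1.

open import Defs
open import Data.Empty using (⊥-elim)
open import Data.List using (List; []; _∷_; length)
open import Data.List.Membership.Propositional using (_∈_)
open import Data.List.Membership.Propositional.Properties.WithK using (unique∧set⇒bag)
open import Data.List.Relation.Binary.BagAndSetEquality using (∼bag⇒↭)
open import Data.List.Relation.Binary.Permutation.Propositional.Properties using (↭-length)
open import Data.List.Relation.Unary.All as All using ([]; _∷_)
open import Data.List.Relation.Unary.AllPairs using ([]; _∷_)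
open import Data.List.Relation.Unary.Any using (here; there)
open import Data.List.Relation.Unary.Unique.Propositional using (Unique)
open import Data.Nat
open import Data.Nat.DivMod
open import Data.Nat.Properties
open import Data.Nat.Tactic.RingSolver using (solve-∀)
open import Data.Product using (Σ; ∃-syntax; _×_; _,_)
open import Data.Sum using (_⊎_; inj₁; inj₂; [_,_]′)
open import Function using (_∘_)
open import Function.Bundles using (mk⇔)
open import Relation.Nullary using (¬_; yes; no)
open import Relation.Binary.PropositionalEquality

fib-≤-suc : ∀ n → fib n ≤ fib (suc n)
fib-≤-suc zero    = z≤n
fib-≤-suc (suc n) = m≤m+n (fib (suc n)) (fib n)

fib-mono : ∀ {m n} → m ≤ n → fib m ≤ fib n
fib-mono = go ∘ ≤⇒≤′
  where
  go : ∀ {m n} → m ≤′ n → fib m ≤ fib n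
  go ≤′-refl           = ≤-refl
  go (≤′-step {n} m≤n) = ≤-trans (go m≤n) (fib-≤-suc n)

fib-pos : ∀ n → 0 < fib (suc n)
fib-pos zero    = z<s
fib-pos (suc n) = ≤-trans (fib-pos n) (m≤m+n (fib (suc n)) (fib n))

fib[n]<fib[3+b] : ∀ b {n} → n ≤ 2 + b → fib n < fib (3 + b)
fib[n]<fib[3+b] b n≤ = ≤-<-trans (fib-mono n≤) (m<m+n (fib (2 + b)) (fib-pos b))

fib-gap : ∀ k p → fib k < fib p → fib (suc k) ≤ fib p
fib-gap k p fk<fp with p ≤? k
... | yes p≤k = ⊥-elim (<⇒≱ fk<fp (fib-mono p≤k))
... | no  p≰k = fib-mono (≰⇒> p≰k)

fib-interval : ∀ k {N} → fib (2 + k) ≤ N → N < fib (3 + k) →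
               ∃[ d ] N ≡ fib (2 + k) + d × d < fib (1 + k)
fib-interval k lo hi with m≤n⇒∃[o]m+o≡n lo
... | d , refl = d , refl , +-cancelˡ-< (fib (2 + k)) d (fib (1 + k)) hi

fib-split : ∀ k {r} → r < fib (3 + k) →
            r < fib (2 + k) ⊎ ∃[ d ] r ≡ fib (2 + k) + d × d < fib (1 + k)
fib-split k {r} r< with fib (2 + k) ≤? r
... | yes lo = inj₂ (fib-interval k lo r<)
... | no  r≱ = inj₁ (≰⇒> r≱)

leading-bound : ∀ k {N R} → N ≡ fib (2 + k) + R → R < fib (1 + k) → N < fib (3 + k)
leading-bound k N≡ R< = subst (_< fib (3 + k)) (sym N≡) (+-monoʳ-< (fib (2 + k)) R<)

-- As f 0 = 0, FibSum t N also holds when N is a sum of fewer than t nonzero Fibonacci numbers.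
data FibSum : ℕ → ℕ → Set where
  []     : FibSum 0 0
  _+fib_ : ∀ {t N} → FibSum t N → (p : ℕ) → FibSum (suc t) (N + fib p)

fibSum-zero : ∀ {N} → FibSum 0 N → N ≡ 0
fibSum-zero [] = refl

fibSum-suc : ∀ {t N} → FibSum t N → FibSum (suc t) N
fibSum-suc {t} {N} s = subst (FibSum (suc t)) (+-identityʳ N) (s +fib 0)

fibSum-mono : ∀ {t t′ N} → t ≤ t′ → FibSum t N → FibSum t′ N
fibSum-mono = go ∘ ≤⇒≤′
  where
  go : ∀ {t t′ N} → t ≤′ t′ → FibSum t N → FibSum t′ N
  go ≤′-refl        s = s
  go (≤′-step t≤t′) s = fibSum-suc (go t≤t′ s)

cancel-head : ∀ a {b c e} → (a + b) + c ≡ a + e → b + c ≡ e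
cancel-head a {b} {c} eq = +-cancelˡ-≡ a _ _ (trans (sym (+-assoc a b c)) eq)

nonleading⇒rest>0 : ∀ k {N₀ R} p → N₀ + fib p ≡ fib (2 + k) + R → fib p < fib (2 + k) → 0 < N₀
nonleading⇒rest>0 k {zero}  {R} p N≡ fp< =
  ⊥-elim (<⇒≱ fp< (subst (fib (2 + k) ≤_) (sym N≡) (m≤m+n _ R)))
nonleading⇒rest>0 k {suc _}     p N≡ fp< = z<s

mutual
  fibSum-removeLeading : ∀ t k {N R} → FibSum (suc t) N → N ≡ fib (2 + k) + R →
                         R < fib (1 + k) → FibSum t R
  fibSum-removeLeading t k {R = R} (_+fib_ {N = N₀} s p) N≡ R< with fib p ≟ fib (2 + k)
  ... | yes fp≡ = subst (FibSum t) N₀≡R s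
    where
    N₀≡R : N₀ ≡ R
    N₀≡R = +-cancelʳ-≡ (fib p) N₀ R (trans N≡ (trans (cong (_+ R) (sym fp≡)) (+-comm _ R)))
  ... | no  fp≢ = removeLeading-notLeading t k s p N≡ R< fp≤ fp<
    where
    fp≤ : fib p ≤ fib (1 + k)
    fp≤ with fib p ≤? fib (1 + k)
    ... | yes fp≤ = fp≤
    ... | no  fp≰ = ⊥-elim (<⇒≱ (leading-bound k N≡ R<) (≤-trans f[3+k]≤fp (m≤n+m (fib p) N₀)))
      where
      f[3+k]≤fp : fib (3 + k) ≤ fib p
      f[3+k]≤fp = fib-gap (2 + k) p (≤∧≢⇒< (fib-gap (1 + k) p (≰⇒> fp≰)) (fp≢ ∘ sym))
    fp< : fib p < fib (2 + k)
    fp< = ≤∧≢⇒< (≤-trans fp≤ (fib-≤-suc (1 + k))) fp≢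

  -- The rest N₀ lies in [f (2+k), ∞), in [f (1+k), f (2+k)), or (as f p ≤ f (1+k)) in
  -- [f k, f (1+k)); in each case drop the leading term of N₀ by induction and rebalance with f p.
  removeLeading-notLeading : ∀ t k {N₀ R} → FibSum t N₀ → ∀ p →
    N₀ + fib p ≡ fib (2 + k) + R → R < fib (1 + k) →
    fib p ≤ fib (1 + k) → fib p < fib (2 + k) → FibSum t R
  removeLeading-notLeading zero k [] p N≡ _ _ fp< = ⊥-elim (n≮n 0 (nonleading⇒rest>0 k p N≡ fp<))
  removeLeading-notLeading (suc t) k {N₀} s p N≡ R< fp≤ fp<
    with fib (2 + k) ≤? N₀ | fib (1 + k) ≤? N₀
  ... | yes lo | _ with fib-interval k lo (≤-<-trans (m≤m+n N₀ (fib p)) (leading-bound k N≡ R<))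
  ...   | d , N₀≡ , d< = subst (FibSum (suc t)) d+fp≡R (fibSum-removeLeading t k s N₀≡ d< +fib p)
    where
    d+fp≡R : d + fib p ≡ _
    d+fp≡R = cancel-head (fib (2 + k)) (trans (cong (_+ fib p) (sym N₀≡)) N≡)
  removeLeading-notLeading (suc t) zero s p N≡ R< fp≤ fp< | no N₀≱ | yes lo = ⊥-elim (N₀≱ lo)
  removeLeading-notLeading (suc t) (suc j) {R = R} s p N≡ R< fp≤ fp< | no N₀≱ | yes lo
    with fib-interval j lo (≰⇒> N₀≱)
  ... | d , N₀≡ , d< = fibSum-removeFib t j (fibSum-removeLeading t j s N₀≡ d< +fib p) d+fp≡ R<
    where
    d+fp≡ : d + fib p ≡ fib (1 + j) + R
    d+fp≡ = cancel-head (fib (2 + j))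
              (trans (cong (_+ fib p) (sym N₀≡)) (trans N≡ (+-assoc (fib (2 + j)) (fib (1 + j)) R)))
  removeLeading-notLeading (suc t) zero s p N≡ R< fp≤ fp< | no _ | no N₀≱ =
    ⊥-elim (N₀≱ (nonleading⇒rest>0 0 p N≡ fp<))
  removeLeading-notLeading (suc t) (suc zero) s p N≡ R< fp≤ fp< | no _ | no N₀≱ =
    ⊥-elim (N₀≱ (nonleading⇒rest>0 1 p N≡ fp<))
  removeLeading-notLeading (suc t) (suc (suc i)) {N₀} {R} s p N≡ R< fp≤ fp< | no _ | no N₀≱
    with fib-interval i lo (≰⇒> N₀≱)
    where
    lo : fib (2 + i) ≤ N₀
    lo = +-cancelˡ-≤ (fib (3 + i)) _ _ (begin
      fib (3 + i) + fib (2 + i) ≤⟨ m≤m+n _ R ⟩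
      fib (4 + i) + R           ≡⟨ sym N≡ ⟩
      N₀ + fib p                ≤⟨ +-monoʳ-≤ N₀ fp≤ ⟩
      N₀ + fib (3 + i)          ≡⟨ +-comm N₀ _ ⟩
      fib (3 + i) + N₀          ∎)
      where open ≤-Reasoning
  ... | d , N₀≡ , d< =
    fibSum-removeFib t (2 + i) (fibSum-removeLeading t i s N₀≡ d< +fib p) d+fp≡
      (<-≤-trans R< (fib-≤-suc (3 + i)))
    where
    d+fp≡ : d + fib p ≡ fib (3 + i) + R
    d+fp≡ = cancel-head (fib (2 + i)) (begin
      (fib (2 + i) + d) + fib p       ≡⟨ cong (_+ fib p) (sym N₀≡) ⟩
      N₀ + fib p                      ≡⟨ N≡ ⟩
      fib (4 + i) + R                 ≡⟨ cong (_+ R) (+-comm (fib (3 + i)) _) ⟩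
      (fib (2 + i) + fib (3 + i)) + R ≡⟨ +-assoc (fib (2 + i)) (fib (3 + i)) R ⟩
      fib (2 + i) + (fib (3 + i) + R) ∎)
      where open ≡-Reasoning

  fibSum-removeFib : ∀ t j {N R} → FibSum (suc t) N → N ≡ fib (1 + j) + R →
                     R < fib (2 + j) → FibSum (suc t) R
  fibSum-removeFib t j {N} {R} s N≡ R< with fib-split j N<
    where
    N< : N < fib (3 + j)
    N< = subst (_< fib (3 + j)) (sym N≡)
           (<-≤-trans (+-monoʳ-< (fib (1 + j)) R<) (≤-reflexive (+-comm (fib (1 + j)) _)))
  ... | inj₂ (d , N≡′ , d<) =
    subst (FibSum (suc t)) d+fj≡R (fibSum-removeLeading t j s N≡′ d< +fib j)
    where
    d+fj≡R : d + fib j ≡ R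
    d+fj≡R = trans (+-comm d (fib j)) (cancel-head (fib (1 + j)) (trans (sym N≡′) N≡))
  fibSum-removeFib t zero    s N≡ R< | inj₁ N< =
    ⊥-elim (<⇒≱ N< (subst (1 ≤_) (sym N≡) (s≤s z≤n)))
  fibSum-removeFib t (suc i) s N≡ R< | inj₁ N< =
    fibSum-suc (fibSum-removeLeading t i s N≡ R<′)
    where
    R<′ : _ < fib (1 + i)
    R<′ = +-cancelˡ-< (fib (2 + i)) _ _ (subst (_< fib (3 + i)) N≡ N<)

fibSum-lowerBound : ∀ a {t N} → FibSum t N → suc N ≡ fib a → ⌊ pred a /2⌋ ≤ t
fibSum-lowerBound 1 _ _ = z≤n
fibSum-lowerBound 2 _ _ = z≤n
fibSum-lowerBound (suc (suc (suc k))) {t} {N} s 1+N≡ with m≤n⇒∃[o]m+o≡n (fib-pos k)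
... | r , 1+r≡ = bound t s
  where
  N≡ : N ≡ fib (2 + k) + r
  N≡ = suc-injective (begin
    suc N                     ≡⟨ 1+N≡ ⟩
    fib (2 + k) + fib (1 + k) ≡⟨ cong (fib (2 + k) +_) (sym 1+r≡) ⟩
    fib (2 + k) + suc r       ≡⟨ +-suc (fib (2 + k)) r ⟩
    suc (fib (2 + k) + r)     ∎)
    where open ≡-Reasoning
  bound : ∀ t → FibSum t N → suc ⌊ k /2⌋ ≤ t
  bound zero    s = ⊥-elim (<⇒≱ (fib-pos (suc k))
                      (subst (fib (2 + k) ≤_) (trans (sym N≡) (fibSum-zero s)) (m≤m+n _ r)))
  bound (suc t) s =
    s≤s (fibSum-lowerBound (suc k) (fibSum-removeLeading t k s N≡ (≤-reflexive 1+r≡)) 1+r≡)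

fibSum-upperBound : ∀ a {r} → r < fib a → FibSum ⌊ pred a /2⌋ r
fibSum-upperBound 1 (s≤s z≤n) = []
fibSum-upperBound 2 (s≤s z≤n) = []
fibSum-upperBound (suc (suc (suc k))) r< =
  [ (λ r<′ → fibSum-mono (⌊n/2⌋-mono (n≤1+n (suc k))) (fibSum-upperBound (suc (suc k)) r<′))
  , (λ (d , r≡ , d<) → subst (FibSum _) (trans (+-comm d _) (sym r≡))
                         (fibSum-upperBound (suc k) d< +fib (2 + k)))
  ]′ (fib-split k r<)

divMod-unique : ∀ {x q r m} .{{_ : NonZero m}} → r < m → x ≡ r + q * m → x / m ≡ q × x % m ≡ r
divMod-unique {x} {q} {r} {m} r<m refl = x/m≡q , x%m≡r
  where
  x%m≡r : x % m ≡ r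
  x%m≡r = trans ([m+kn]%n≡m%n r q m) (m<n⇒m%n≡m r<m)
  x/m≡q : x / m ≡ q
  x/m≡q = *-cancelʳ-≡ (x / m) q m (+-cancelˡ-≡ r _ _ (begin
    r + x / m * m     ≡⟨ cong (_+ x / m * m) (sym x%m≡r) ⟩
    x % m + x / m * m ≡⟨ sym (m≡m%n+[m/n]*n x m) ⟩
    r + q * m         ∎))
    where open ≡-Reasoning

+-swap-inner : ∀ x y z w → (x + y) + (z + w) ≡ (x + w) + (z + y)
+-swap-inner = solve-∀

InS-+ : ∀ {a x y} → InS a x → InS a y → InS a (x + y)
InS-+ {a} {x} x∈ zero∈            = subst (InS a) (sym (+-identityʳ x)) x∈
InS-+ {a} {x} x∈ (step∈ {y} n y∈) = subst (InS a) (+-assoc x y _) (step∈ n (InS-+ x∈ y∈))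

GenBy-+ : ∀ {G x y} → GenBy G x → GenBy G y → GenBy G (x + y)
GenBy-+ {G} {x} x∈ zero∈              = subst (GenBy G) (sym (+-identityʳ x)) x∈
GenBy-+ {G} {x} x∈ (step∈ {y} g∈G y∈) =
  subst (GenBy G) (+-assoc x y _) (step∈ g∈G (GenBy-+ x∈ y∈))

GenBy⇒InS : ∀ {a G x} → (∀ {g} → g ∈ G → InS a g) → GenBy G x → InS a x
GenBy⇒InS G⊆S zero∈          = zero∈
GenBy⇒InS G⊆S (step∈ g∈G x∈) = InS-+ (GenBy⇒InS G⊆S x∈) (G⊆S g∈G)

InS⇒≡0⊎fib≤ : ∀ {a x} → InS a x → x ≡ 0 ⊎ fib a ≤ x
InS⇒≡0⊎fib≤ zero∈               = inj₁ refl
InS⇒≡0⊎fib≤ {a} (step∈ {x} n _) = inj₂ (≤-trans (m≤m+n (fib a) (fib n)) (m≤n+m _ x))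

-- x cannot split into two nonzero elements of S(a), as these are at least f a each.
small∈generators : ∀ {a H x} → (∀ {h} → h ∈ H → InS a h) → GenBy H x →
                   0 < x → x < fib a + fib a → x ∈ H
small∈generators H⊆S (step∈ {x} {g} g∈H x∈) 0<x+g x+g< with InS⇒≡0⊎fib≤ (H⊆S g∈H)
... | inj₁ refl =
  subst (_∈ _) (sym (+-identityʳ x))
    (small∈generators H⊆S x∈ (subst (0 <_) (+-identityʳ x) 0<x+g) (subst (_< _) (+-identityʳ x) x+g<))
... | inj₂ fib≤g with InS⇒≡0⊎fib≤ (GenBy⇒InS H⊆S x∈)
...   | inj₁ refl  = g∈H
...   | inj₂ fib≤x = ⊥-elim (<⇒≱ x+g< (+-mono-≤ fib≤x fib≤g))

unique⊆⊇⇒length≡ : ∀ {xs ys : List ℕ} → Unique xs → Unique ys →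
                   (∀ {x} → x ∈ xs → x ∈ ys) → (∀ {x} → x ∈ ys → x ∈ xs) →
                   length xs ≡ length ys
unique⊆⊇⇒length≡ xs! ys! xs⊆ys ys⊆xs =
  ↭-length (∼bag⇒↭ (unique∧set⇒bag xs! ys! (mk⇔ xs⊆ys ys⊆xs)))

-- m + f n for n = 2 + b, …, 2 and n = 0; n = 1 is left out because f 1 = f 2.
atoms : ℕ → ℕ → List ℕ
atoms m zero    = m + fib 2 ∷ m + fib 0 ∷ []
atoms m (suc b) = m + fib (3 + b) ∷ atoms m b

length-atoms : ∀ m b → length (atoms m b) ≡ 2 + b
length-atoms m zero    = refl
length-atoms m (suc b) = cong suc (length-atoms m b)

∈-atoms⁻ : ∀ m b {x} → x ∈ atoms m b → ∃[ n ] n ≤ 2 + b × x ≡ m + fib n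
∈-atoms⁻ m zero    (here refl)         = 2 , ≤-refl , refl
∈-atoms⁻ m zero    (there (here refl)) = 0 , z≤n , refl
∈-atoms⁻ m (suc b) (here refl)         = 3 + b , ≤-refl , refl
∈-atoms⁻ m (suc b) (there x∈)          =
  let n , n≤ , x≡ = ∈-atoms⁻ m b x∈ in n , m≤n⇒m≤1+n n≤ , x≡

∈-atoms⁺ : ∀ m b {n} → n ≤ 2 + b → m + fib n ∈ atoms m b
∈-atoms⁺ m zero    {0}                 _ = there (here refl)
∈-atoms⁺ m zero    {1}                 _ = here refl
∈-atoms⁺ m zero    {2}                 _ = here refl
∈-atoms⁺ m zero    {suc (suc (suc _))} (s≤s (s≤s ()))
∈-atoms⁺ m (suc b) {n} n≤ with n ≟ 3 + b
... | yes refl = here refl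
... | no  n≢   = there (∈-atoms⁺ m b (s≤s⁻¹ (≤∧≢⇒< n≤ n≢)))

atoms-unique : ∀ m b → Unique (atoms m b)
atoms-unique m zero    = (m+1≢m+0 ∷ []) ∷ [] ∷ []
  where
  m+1≢m+0 : m + 1 ≢ m + 0
  m+1≢m+0 eq with +-cancelˡ-≡ m 1 0 eq
  ... | ()
atoms-unique m (suc b) = All.tabulate head-fresh ∷ atoms-unique m b
  where
  head-fresh : ∀ {x} → x ∈ atoms m b → m + fib (3 + b) ≢ x
  head-fresh x∈ with ∈-atoms⁻ m b x∈
  ... | n , n≤ , refl = <⇒≢ (+-monoʳ-< m (fib[n]<fib[3+b] b n≤)) ∘ sym

module FibonacciSemigroup (b : ℕ) where

  a m K F : ℕ
  a = 3 + b
  m = fib a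
  K = ⌊ b /2⌋
  F = pred m + K * m

  instance
    m-nonZero : NonZero m
    m-nonZero = >-nonZero (fib-pos (2 + b))

  atom∈S : ∀ {x} → x ∈ atoms m b → InS a x
  atom∈S x∈ with ∈-atoms⁻ m b x∈
  ... | n , _ , refl = step∈ n zero∈

  atom-small : ∀ {x} → x ∈ atoms m b → 0 < x × x < m + m
  atom-small x∈ with ∈-atoms⁻ m b x∈
  ... | n , n≤ , refl =
    ≤-trans (fib-pos (2 + b)) (m≤m+n m (fib n)) , +-monoʳ-< m (fib[n]<fib[3+b] b n≤)

  fib-GenBy : ∀ d → GenBy (atoms m b) (fib (d + a))
  fib-GenBy zero          = subst (GenBy _) (+-identityʳ m) (step∈ (∈-atoms⁺ m b z≤n) zero∈)
  fib-GenBy (suc zero)    = step∈ (∈-atoms⁺ m b ≤-refl) zero∈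
  fib-GenBy (suc (suc d)) = GenBy-+ (fib-GenBy (suc d)) (fib-GenBy d)

  generator-GenBy : ∀ n → GenBy (atoms m b) (m + fib n)
  generator-GenBy n with n ≤? 2 + b
  ... | yes n≤ = step∈ (∈-atoms⁺ m b n≤) zero∈
  ... | no  n≰ with m≤n⇒∃[o]m+o≡n (≰⇒> n≰)
  ...   | d , a+d≡n = subst (GenBy _) eq (step∈ (∈-atoms⁺ m b z≤n) (fib-GenBy d))
    where
    eq : fib (d + a) + (m + fib 0) ≡ m + fib n
    eq = trans (+-comm (fib (d + a)) (m + fib 0))
               (cong₂ _+_ (+-identityʳ m) (cong fib (trans (+-comm d a) a+d≡n)))

  InS⇒GenBy : ∀ {x} → InS a x → GenBy (atoms m b) x
  InS⇒GenBy zero∈        = zero∈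
  InS⇒GenBy (step∈ n x∈) = GenBy-+ (InS⇒GenBy x∈) (generator-GenBy n)

  atoms-generate : Generates a (atoms m b)
  atoms-generate = atom∈S , λ _ → InS⇒GenBy

  atom∈generators : ∀ {H x} → Generates a H → x ∈ atoms m b → x ∈ H
  atom∈generators (H⊆S , S⊆H) x∈ =
    let 0<x , x<2m = atom-small x∈ in small∈generators H⊆S (S⊆H _ (atom∈S x∈)) 0<x x<2m

  atoms-minimal : IsMinimalGeneratingSystem a (atoms m b)
  atoms-minimal = atoms-unique m b , atoms-generate , λ _ _ H-gen → atom∈generators H-gen

  minimal-length : ∀ {G} → IsMinimalGeneratingSystem a G → length G ≡ 2 + b
  minimal-length {G} (G! , G-gen , G-min) =
    trans (unique⊆⊇⇒length≡ G! (atoms-unique m b) (G-min (atoms m b) A⊆G atoms-generate) A⊆G)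
          (length-atoms m b)
    where
    A⊆G : ∀ {x} → x ∈ atoms m b → x ∈ G
    A⊆G = atom∈generators G-gen

  fibSum⇒InS : ∀ {q r} → FibSum q r → InS a (r + q * m)
  fibSum⇒InS []                   = zero∈
  fibSum⇒InS (_+fib_ {t} {N} s p) =
    subst (InS a) (+-swap-inner N (t * m) m (fib p)) (step∈ p (fibSum⇒InS s))

  -- Either x % m + f n stays below m, or one m is carried and fibSum-removeFib pays for it.
  fibSum-addAtom : ∀ x n → fib n < m → FibSum (x / m) (x % m) →
                   FibSum ((x + (m + fib n)) / m) ((x + (m + fib n)) % m)
  fibSum-addAtom x n fn<m s with m ≤? x % m + fib n
  ... | no r+fn≱ =
    let q≡ , r≡ = divMod-unique (≰⇒> r+fn≱) x+g≡ in subst₂ FibSum (sym q≡) (sym r≡) (s +fib n)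
    where
    x+g≡ : x + (m + fib n) ≡ (x % m + fib n) + suc (x / m) * m
    x+g≡ = trans (cong (_+ (m + fib n)) (m≡m%n+[m/n]*n x m)) (+-swap-inner (x % m) _ m (fib n))
  ... | yes m≤r+fn with m≤n⇒∃[o]m+o≡n m≤r+fn
  ...   | w , m+w≡ =
    let q≡ , r≡ = divMod-unique w<m x+g≡ in subst₂ FibSum (sym q≡) (sym r≡) (fibSum-suc carry)
    where
    w<m : w < m
    w<m = +-cancelˡ-< m w m (subst (_< m + m) (sym m+w≡) (+-mono-< (m%n<n x m) fn<m))
    x+g≡ : x + (m + fib n) ≡ w + suc (suc (x / m)) * m
    x+g≡ = begin
      x + (m + fib n)                   ≡⟨ cong (_+ (m + fib n)) (m≡m%n+[m/n]*n x m) ⟩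
      (x % m + x / m * m) + (m + fib n) ≡⟨ +-swap-inner (x % m) _ m (fib n) ⟩
      (x % m + fib n) + (m + x / m * m) ≡⟨ cong (_+ (m + x / m * m)) (sym m+w≡) ⟩
      (m + w) + (m + x / m * m)         ≡⟨ cong (_+ (m + x / m * m)) (+-comm m w) ⟩
      (w + m) + (m + x / m * m)         ≡⟨ +-assoc w m _ ⟩
      w + (m + (m + x / m * m))         ∎
      where open ≡-Reasoning
    carry : FibSum (suc (x / m)) w
    carry = fibSum-removeFib (x / m) (2 + b) (s +fib n) (sym m+w≡)
              (<-≤-trans w<m (fib-≤-suc (3 + b)))

  GenBy⇒fibSum : ∀ {x} → GenBy (atoms m b) x → FibSum (x / m) (x % m)
  GenBy⇒fibSum zero∈ =
    let q≡ , r≡ = divMod-unique (fib-pos (2 + b)) refl in subst₂ FibSum (sym q≡) (sym r≡) []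
  GenBy⇒fibSum (step∈ {x} g∈ x∈) with ∈-atoms⁻ m b g∈
  ... | n , n≤ , refl = fibSum-addAtom x n (fib[n]<fib[3+b] b n≤) (GenBy⇒fibSum x∈)

  InS⇒fibSum : ∀ {x} → InS a x → FibSum (x / m) (x % m)
  InS⇒fibSum = GenBy⇒fibSum ∘ InS⇒GenBy

  suc-F : suc F ≡ m + K * m
  suc-F = cong (_+ K * m) (suc-pred m)

  F∉S : ¬ InS a F
  F∉S F∈ =
    let q≡K , r≡pred-m = divMod-unique {q = K} (≤-reflexive (suc-pred m)) refl
    in n≮n K (fibSum-lowerBound a (subst₂ FibSum q≡K r≡pred-m (InS⇒fibSum F∈)) (suc-pred m))

  F<⇒∈S : ∀ x → F < x → InS a x
  F<⇒∈S x F<x =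
    subst (InS a) (sym (m≡m%n+[m/n]*n x m))
      (fibSum⇒InS (fibSum-mono K<x/m (fibSum-upperBound a (m%n<n x m))))
    where
    K<x/m : suc K ≤ x / m
    K<x/m = begin
      suc K         ≡⟨ sym (m*n/n≡m (suc K) m) ⟩
      suc K * m / m ≤⟨ /-monoˡ-≤ m (subst (_≤ x) suc-F F<x) ⟩
      x / m         ∎
      where open ≤-Reasoning

  multiplicity : IsMultiplicity a m
  multiplicity = fib-pos (2 + b) , subst (InS a) (+-identityʳ m) (step∈ 0 zero∈) , m≤
    where
    m≤ : ∀ x → 0 < x → InS a x → m ≤ x
    m≤ x 0<x x∈ with InS⇒≡0⊎fib≤ x∈
    ... | inj₁ refl = ⊥-elim (n≮n 0 0<x)
    ... | inj₂ m≤x  = m≤x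

  frobenius-formula : ∀ G → IsMinimalGeneratingSystem a G → F + 1 ≡ ⌊ length G /2⌋ * m
  frobenius-formula G G-min = begin
    F + 1              ≡⟨ +-comm F 1 ⟩
    suc F              ≡⟨ suc-F ⟩
    ⌊ 2 + b /2⌋ * m    ≡⟨ cong (λ e → ⌊ e /2⌋ * m) (sym (minimal-length G-min)) ⟩
    ⌊ length G /2⌋ * m ∎
    where open ≡-Reasoning

corollary25 : (a : ℕ) → 3 ≤ a →
    Σ ℕ λ F → Σ ℕ λ m →
      IsFrobenius a F × IsMultiplicity a m ×
      Σ (List ℕ) (IsMinimalGeneratingSystem a) ×
      (∀ (G : List ℕ) → IsMinimalGeneratingSystem a G →
         F + 1 ≡ ⌊ length G /2⌋ * m)
corollary25 (suc (suc (suc b))) _ =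
  F , m , (F∉S , F<⇒∈S) , multiplicity , (atoms m b , atoms-minimal) , frobenius-formula
  where open FibonacciSemigroup b
corollary25 (suc zero)       (s≤s ())
corollary25 (suc (suc zero)) (s≤s (s≤s ()))
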